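{- Let $A=\{a_1<\dots<a_s\}$ and $B=\{b_1<\dots<b_s\}$ be subsets of $[n]$ with $s\ge2$. If $x_{a_i,b_j}$ divides $\mathrm{lm}_\preceq(\det M(A,B))$, then $$\mathrm{lm}_\preceq\big(\det M(A\setminus\{a_i\},B\setminus\{b_j\})\big)\cdot x_{a_i,b_j}=\mathrm{lm}_\preceq(\det M(A,B)).$$
   Context: $X=(x_{ij})_{1\le i,j\le n}$ is a matrix of indeterminates over a field $\mathbb K$, and $M(A,B)=(x_{ij})_{i\in A,j\in B}$. Term order $\preceq$: let $\varphi(i,j)=\big[((2-i)n+(j-1)(n-1)-1)\bmod n^2\big]+1$, with the usual residue in $\{0,\dots,n^2-1\}$. Order the variables by $x_{ij}\preceq x_{kl}$ iff $\varphi(i,j)\le\varphi(k,l)$. Then $\preceq$ is the degree reverse lexicographic order for this variable order. $\mathrm{lm}_\preceq(f)$ is the $\preceq$-largest monomial of $f$ with nonzero coefficient. -}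

module Defs where

open import Level using (Level; _⊔_)
open import Algebra.Bundles using (CommutativeRing)
open import Data.Nat as ℕ using (ℕ; zero; suc; _≤_; _<_)
open import Data.Nat.DivMod using (_%_)
open import Data.Fin as Fin using (Fin; toℕ; punchIn)
open import Data.Fin.Properties using (all?)
open import Data.Nat.Properties using (_≟_)
open import Data.List using (List; []; _∷_; _++_; map; concatMap; foldr; tabulate)
open import Data.Product using (_×_; _,_; proj₁; proj₂; ∃; Σ)
open import Data.Sum using (_⊎_)
open import Relation.Nullary using (¬_; Dec; yes; no)
open import Relation.Binary.PropositionalEquality using (_≡_; _≢_)

record Field (c ℓ : Level) : Set (Level.suc (c ⊔ ℓ)) where
  field
    commRing : CommutativeRing c ℓ
  open CommutativeRing commRing public
  field
    1≉0     : ¬ (1# ≈ 0#)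
    inverse : ∀ x → ¬ (x ≈ 0#) → Σ Carrier λ y → (x * y) ≈ 1#

sumFin : ∀ {n} → (Fin n → ℕ) → ℕ
sumFin {zero}  f = 0
sumFin {suc n} f = f Fin.zero ℕ.+ sumFin (λ i → f (Fin.suc i))

-- Monomials in the n² variables x_ij (indices 0-based: Fin n stands for
-- {1,…,n} via i ↦ toℕ i + 1): exponent matrices.

Monomial : ℕ → Set
Monomial n = Fin n → Fin n → ℕ

deg : ∀ {n} → Monomial n → ℕ
deg m = sumFin (λ i → sumFin (λ j → m i j))

_·ₘ_ : ∀ {n} → Monomial n → Monomial n → Monomial n
(m ·ₘ m') i j = m i j ℕ.+ m' i j

var : ∀ {n} → Fin n → Fin n → Monomial n
var k l i j with Fin._≟_ i k | Fin._≟_ j l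
... | yes _ | yes _ = 1
... | _     | _     = 0

_≈ₘ_ : ∀ {n} → Monomial n → Monomial n → Set
m ≈ₘ m' = ∀ i j → m i j ≡ m' i j

_≈ₘ?_ : ∀ {n} (m m' : Monomial n) → Dec (m ≈ₘ m')
m ≈ₘ? m' = all? (λ i → all? (λ j → m i j ≟ m' i j))

-- The variable order: φ(i,j) = [((2-i)n + (j-1)(n-1) - 1) mod n²] + 1
-- (1-based i, j).  Since (2-i)n ≡ (n+2-i)n (mod n²) and
-- (n+2-i)n + (j-1)(n-1) - 1 ≥ 0 for 1 ≤ i ≤ n, we compute in ℕ with
-- i = toℕ i' + 1, j = toℕ j' + 1.

φ : ∀ {n} → Fin n → Fin n → ℕ
φ {suc m} i j =
  ((((suc m ℕ.+ 1 ℕ.∸ toℕ i) ℕ.* suc m ℕ.+ toℕ j ℕ.* m) ℕ.∸ 1) % (suc m ℕ.* suc m)) ℕ.+ 1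

_≺ᵥ_ : ∀ {n} → Fin n × Fin n → Fin n × Fin n → Set
(i , j) ≺ᵥ (k , l) = φ i j < φ k l

_≺_ : ∀ {n} → Monomial n → Monomial n → Set
_≺_ {n} m m' =
  deg m < deg m' ⊎
  (deg m ≡ deg m' ×
    Σ (Fin n × Fin n) λ v →
      (m' (proj₁ v) (proj₂ v) < m (proj₁ v) (proj₂ v)) ×
      (∀ w → w ≺ᵥ v → m (proj₁ w) (proj₂ w) ≡ m' (proj₁ w) (proj₂ w)))

_⪯_ : ∀ {n} → Monomial n → Monomial n → Set
m ⪯ m' = m ≈ₘ m' ⊎ m ≺ m'

module Poly {c ℓ} (K : Field c ℓ) (n : ℕ) where
  open Field K

  Poly : Set c
  Poly = List (Carrier × Monomial n)

  0ₚ : Poly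
  0ₚ = []

  _+ₚ_ : Poly → Poly → Poly
  _+ₚ_ = _++_

  -ₚ_ : Poly → Poly
  -ₚ_ = map (λ t → (- proj₁ t) , proj₂ t)

  _*ₚ_ : Poly → Poly → Poly
  p *ₚ q = concatMap (λ t → map (λ u → (proj₁ t * proj₁ u) , (proj₂ t ·ₘ proj₂ u)) q) p

  X : Fin n → Fin n → Poly
  X k l = (1# , var k l) ∷ []

  coeff : Poly → Monomial n → Carrier
  coeff [] m = 0#
  coeff ((a , m') ∷ p) m with m' ≈ₘ? m
  ... | yes _ = a + coeff p m
  ... | no  _ = coeff p m

  IsLM : Poly → Monomial n → Set ℓ
  IsLM f L = ¬ (coeff f L ≈ 0#) × (∀ m → ¬ (coeff f m ≈ 0#) → m ⪯ L)

  det : ∀ {s} → (Fin s → Fin s → Poly) → Poly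
  det {zero}  M = (1# , (λ _ _ → 0)) ∷ []
  det {suc s} M = go M
    where
    sgn : ℕ → Poly → Poly
    sgn zero p = p
    sgn (suc zero) p = -ₚ p
    sgn (suc (suc k)) p = sgn k p
    go : (Fin (suc s) → Fin (suc s) → Poly) → Poly
    go M = foldr _+ₚ_ 0ₚ
      (map (λ j → sgn (toℕ j) (M Fin.zero j *ₚ
                     det (λ r c → M (Fin.suc r) (punchIn j c))))
           (tabulate (λ j → j)))

  -- the submatrix M(A,B) of X, for A, B given by their (increasing)
  -- enumerations a, b : Fin s → Fin n
  subM : ∀ {s} → (Fin s → Fin n) → (Fin s → Fin n) → Fin s → Fin s → Poly
  subM a b r c = X (a r) (b c)

StrictlyIncreasing : ∀ {s n} → (Fin s → Fin n) → Set
StrictlyIncreasing a = ∀ r r' → r Fin.< r' → a r Fin.< a r'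

{-# OPTIONS --safe #-}
-- Since the rows a and the columns b are distinct, different permutations σ give different
-- monomials ∏ᵣ x_{a r, b (σ r)}, so nothing cancels in the expansion of the determinant: its
-- support is exactly the set of these permutation monomials (by induction along the Laplace
-- expansion). The leading monomial L is therefore the monomial of some σ, and x_{a i, b j} ∣ L
-- forces σ i = j, so L = L′ · x_{a i, b j} with L′ the monomial of the permutation induced on the
-- minor. Every monomial m of the minor gives the monomial m · x_{a i, b j} of the whole
-- determinant, hence m · x_{a i, b j} ⪯ L′ · x_{a i, b j}, and m ⪯ L′ by cancellation. Nothing
-- about the particular variable order is used beyond this compatibility with multiplication.
module Submission where

open import Defs
open import Level using (Level)
open import Data.Nat using (ℕ; suc; _≤_)
open import Data.Fin using (Fin; punchIn)
open import Data.Product using (Σ; _×_)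
open import Function using (_∘_)

open import Level using (0ℓ)
open import Data.Nat using (zero; _∸_; _<_; z≤n)
import Data.Nat as ℕ
import Data.Nat.Properties as ℕ
open import Data.Fin as Fin using (_≟_)
open import Data.Fin.Properties using (punchIn-injective; suc-injective; 0≢1+n; <-cmp; <-irrefl)
open import Data.Fin.Permutation as Permutation
  using (Permutation′; _⟨$⟩ʳ_; insert; remove; insert-punchIn; insert-remove)
open import Data.List using ([]; _∷_; map; foldr; tabulate)
open import Data.List.Properties using (map-tabulate; ++-identityʳ)
open import Data.Product using (_,_; proj₁; proj₂; ∃)
open import Data.Sum using (_⊎_; inj₁; inj₂; [_,_])
open import Data.Empty using (⊥-elim)
open import Function using (id)
open import Function.Definitions using (Injective)
open import Relation.Binary.Definitions using (tri<; tri≈; tri>)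
open import Relation.Binary.PropositionalEquality
  using (_≡_; _≢_; _≗_; refl; sym; trans; cong; cong₂; subst; subst₂; module ≡-Reasoning)
open import Relation.Nullary using (yes; no; contradiction)
open import Relation.Unary using (Pred; _∈_; _∉_; _∪_; _⊆_; _⊥_; _≐_; ⋃)
open import Relation.Unary.Properties using (≐-sym)
open import Algebra.Properties.CommutativeMonoid.Sum ℕ.+-0-commutativeMonoid
  using (sum; sum-cong-≗; ∑-distrib-+; sum-remove; sum-replicate-zero)
import Algebra.Properties.Ring as RingProperties

sumFin≡sum : ∀ {s} (f : Fin s → ℕ) → sumFin f ≡ sum f
sumFin≡sum {zero}  f = refl
sumFin≡sum {suc s} f = cong (f Fin.zero ℕ.+_) (sumFin≡sum (f ∘ Fin.suc))

module _ {s : ℕ} where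

  sumFin-cong : {f g : Fin s → ℕ} → f ≗ g → sumFin f ≡ sumFin g
  sumFin-cong {f} {g} f≗g = trans (sumFin≡sum f) (trans (sum-cong-≗ f≗g) (sym (sumFin≡sum g)))

  sumFin-zero : {f : Fin s → ℕ} → f ≗ (λ _ → 0) → sumFin f ≡ 0
  sumFin-zero f≗0 =
    trans (sumFin-cong f≗0) (trans (sumFin≡sum {s} (λ _ → 0)) (sum-replicate-zero s))

  sumFin-+ : (f g : Fin s → ℕ) → sumFin (λ r → f r ℕ.+ g r) ≡ sumFin f ℕ.+ sumFin g
  sumFin-+ f g =
    trans (sumFin≡sum (λ r → f r ℕ.+ g r))
          (trans (∑-distrib-+ f g) (sym (cong₂ ℕ._+_ (sumFin≡sum f) (sumFin≡sum g))))

sumFin-punchIn : ∀ {s} (f : Fin (suc s) → ℕ) i → sumFin f ≡ f i ℕ.+ sumFin (f ∘ punchIn i)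
sumFin-punchIn f i =
  trans (sumFin≡sum f) (trans (sum-remove f) (cong (f i ℕ.+_) (sym (sumFin≡sum (f ∘ punchIn i)))))

module _ {n : ℕ} where

  ≈ₘ-refl : {x : Monomial n} → x ≈ₘ x
  ≈ₘ-refl i j = refl

  ≈ₘ-sym : {x y : Monomial n} → x ≈ₘ y → y ≈ₘ x
  ≈ₘ-sym x≈y i j = sym (x≈y i j)

  ≈ₘ-trans : {x y z : Monomial n} → x ≈ₘ y → y ≈ₘ z → x ≈ₘ z
  ≈ₘ-trans x≈y y≈z i j = trans (x≈y i j) (y≈z i j)

  ·ₘ-comm : (x y : Monomial n) → (x ·ₘ y) ≈ₘ (y ·ₘ x)
  ·ₘ-comm x y i j = ℕ.+-comm (x i j) (y i j)

  ·ₘ-congʳ : {x y : Monomial n} (v : Monomial n) → x ≈ₘ y → (x ·ₘ v) ≈ₘ (y ·ₘ v)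
  ·ₘ-congʳ v x≈y i j = cong (ℕ._+ v i j) (x≈y i j)

  ·ₘ-cancelʳ : {x y : Monomial n} (v : Monomial n) → (x ·ₘ v) ≈ₘ (y ·ₘ v) → x ≈ₘ y
  ·ₘ-cancelʳ {x} {y} v xv≈yv i j = ℕ.+-cancelʳ-≡ (v i j) (x i j) (y i j) (xv≈yv i j)

  var-diag : (k l : Fin n) → var k l k l ≡ 1
  var-diag k l with k ≟ k | l ≟ l
  ... | yes _   | yes _   = refl
  ... | no k≢k  | _       = contradiction refl k≢k
  ... | yes _   | no l≢l  = contradiction refl l≢l

  var-offRow : {k l i j : Fin n} → i ≢ k → var k l i j ≡ 0
  var-offRow {k} {l} {i} {j} i≢k with i ≟ k | j ≟ l
  ... | yes i≡k | _     = contradiction i≡k i≢k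
  ... | no _    | yes _ = refl
  ... | no _    | no _  = refl

  var-offCol : {k l i j : Fin n} → j ≢ l → var k l i j ≡ 0
  var-offCol {k} {l} {i} {j} j≢l with i ≟ k | j ≟ l
  ... | _     | yes j≡l = contradiction j≡l j≢l
  ... | yes _ | no _    = refl
  ... | no _  | no _    = refl

  var≤ : (m : Monomial n) {k l : Fin n} → 1 ≤ m k l → ∀ i j → var k l i j ≤ m i j
  var≤ m {k} {l} 1≤mkl i j with i ≟ k | j ≟ l
  ... | yes refl | yes refl = 1≤mkl
  ... | yes _    | no _     = z≤n
  ... | no _     | _        = z≤n

  ·var-divisible : (m : Monomial n) (k l : Fin n) → 1 ≤ (m ·ₘ var k l) k l
  ·var-divisible m k l =
    subst (1 ≤_) (cong (m k l ℕ.+_) (sym (var-diag k l))) (ℕ.m≤n+m 1 (m k l))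

  divisible⇒·var : (m : Monomial n) {k l : Fin n} → 1 ≤ m k l →
                   ∃ λ m′ → m ≈ₘ (m′ ·ₘ var k l)
  divisible⇒·var m {k} {l} 1≤mkl =
    (λ i j → m i j ∸ var k l i j) , λ i j → sym (ℕ.m∸n+n≡m (var≤ m 1≤mkl i j))

  deg-cong : {x y : Monomial n} → x ≈ₘ y → deg x ≡ deg y
  deg-cong x≈y = sumFin-cong (λ i → sumFin-cong (x≈y i))

  deg-·ₘ : (x y : Monomial n) → deg (x ·ₘ y) ≡ deg x ℕ.+ deg y
  deg-·ₘ x y = trans (sumFin-cong (λ i → sumFin-+ (x i) (y i)))
                     (sumFin-+ (λ i → sumFin (x i)) (λ i → sumFin (y i)))

  ⪯-respʳ-≈ₘ : {x y z : Monomial n} → x ⪯ y → y ≈ₘ z → x ⪯ z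
  ⪯-respʳ-≈ₘ (inj₁ x≈y) y≈z = inj₁ (≈ₘ-trans x≈y y≈z)
  ⪯-respʳ-≈ₘ {x} (inj₂ (inj₁ deg<)) y≈z = inj₂ (inj₁ (subst (deg x <_) (deg-cong y≈z) deg<))
  ⪯-respʳ-≈ₘ {x} (inj₂ (inj₂ (deg≡ , (w , w-lt , below-w)))) y≈z =
    inj₂ (inj₂ (trans deg≡ (deg-cong y≈z) ,
      (w , subst (_< x (proj₁ w) (proj₂ w)) (y≈z (proj₁ w) (proj₂ w)) w-lt ,
       λ v v≺w → trans (below-w v v≺w) (y≈z (proj₁ v) (proj₂ v)))))

  ⪯-cancelʳ-·ₘ : {x y : Monomial n} (v : Monomial n) → (x ·ₘ v) ⪯ (y ·ₘ v) → x ⪯ y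
  ⪯-cancelʳ-·ₘ v (inj₁ xv≈yv) = inj₁ (·ₘ-cancelʳ v xv≈yv)
  ⪯-cancelʳ-·ₘ {x} {y} v (inj₂ (inj₁ deg<)) =
    inj₂ (inj₁ (ℕ.+-cancelʳ-< (deg v) (deg x) (deg y)
                  (subst₂ _<_ (deg-·ₘ x v) (deg-·ₘ y v) deg<)))
  ⪯-cancelʳ-·ₘ {x} {y} v (inj₂ (inj₂ (deg≡ , ((w₁ , w₂) , w-lt , below-w)))) =
    inj₂ (inj₂ (ℕ.+-cancelʳ-≡ (deg v) (deg x) (deg y)
                  (trans (sym (deg-·ₘ x v)) (trans deg≡ (deg-·ₘ y v))) ,
      ((w₁ , w₂) , ℕ.+-cancelʳ-< (v w₁ w₂) (y w₁ w₂) (x w₁ w₂) w-lt ,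
       λ u u≺w → ℕ.+-cancelʳ-≡ (v (proj₁ u) (proj₂ u)) _ _ (below-w u u≺w))))

StrictlyIncreasing⇒Injective : ∀ {s n} {a : Fin s → Fin n} →
                               StrictlyIncreasing a → Injective _≡_ _≡_ a
StrictlyIncreasing⇒Injective {a = a} a↑ {x} {y} ax≡ay with <-cmp x y
... | tri< x<y _ _ = contradiction (a↑ x y x<y) (<-irrefl ax≡ay)
... | tri≈ _ x≡y _ = x≡y
... | tri> _ _ y<x = contradiction (a↑ y x y<x) (<-irrefl (sym ax≡ay))

∘punchIn-injective : ∀ {s} {A : Set} {f : Fin (suc s) → A} i → Injective _≡_ _≡_ f →
                     Injective _≡_ _≡_ (f ∘ punchIn i)
∘punchIn-injective i f-inj fx≡fy = punchIn-injective i _ _ (f-inj fx≡fy)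

insert-diag : ∀ {s} i j (τ : Permutation′ s) → insert i j τ ⟨$⟩ʳ i ≡ j
insert-diag i j τ with i ≟ i
... | yes _   = refl
... | no i≢i  = contradiction refl i≢i

module _ {n : ℕ} where

  permMonomial : ∀ {s} (a b : Fin s → Fin n) → Permutation′ s → Monomial n
  permMonomial a b σ k l = sumFin (λ r → var (a r) (b (σ ⟨$⟩ʳ r)) k l)

  IsPermMonomial : ∀ {s} (a b : Fin s → Fin n) → Pred (Monomial n) 0ℓ
  IsPermMonomial {s} a b m = Σ (Permutation′ s) λ σ → m ≈ₘ permMonomial a b σ

  IsPermMonomialAt : ∀ {s} (a b : Fin (suc s) → Fin n) (i j : Fin (suc s)) → Pred (Monomial n) 0ℓ
  IsPermMonomialAt a b i j m =
    ∃ λ m′ → IsPermMonomial (a ∘ punchIn i) (b ∘ punchIn j) m′ × m ≈ₘ (m′ ·ₘ var (a i) (b j))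

  permMonomial-cong : ∀ {s} (a b : Fin s → Fin n) {σ τ : Permutation′ s} →
                      σ Permutation.≈ τ → permMonomial a b σ ≈ₘ permMonomial a b τ
  permMonomial-cong a b σ≈τ k l = sumFin-cong (λ r → cong (λ c → var (a r) (b c) k l) (σ≈τ r))

  permMonomial-insert : ∀ {s} (a b : Fin (suc s) → Fin n) i j (τ : Permutation′ s) →
    permMonomial a b (insert i j τ) ≈ₘ
    (permMonomial (a ∘ punchIn i) (b ∘ punchIn j) τ ·ₘ var (a i) (b j))
  permMonomial-insert a b i j τ k l = begin
    permMonomial a b σ k l
      ≡⟨ sumFin-punchIn (λ r → var (a r) (b (σ ⟨$⟩ʳ r)) k l) i ⟩
    var (a i) (b (σ ⟨$⟩ʳ i)) k l ℕ.+
      sumFin (λ r → var (a (punchIn i r)) (b (σ ⟨$⟩ʳ punchIn i r)) k l)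
      ≡⟨ cong₂ ℕ._+_ (cong (λ c → var (a i) (b c) k l) (insert-diag i j τ))
           (sumFin-cong λ r → cong (λ c → var (a (punchIn i r)) (b c) k l) (insert-punchIn i j τ r)) ⟩
    var (a i) (b j) k l ℕ.+ permMonomial (a ∘ punchIn i) (b ∘ punchIn j) τ k l
      ≡⟨ ℕ.+-comm (var (a i) (b j) k l) _ ⟩
    (permMonomial (a ∘ punchIn i) (b ∘ punchIn j) τ ·ₘ var (a i) (b j)) k l ∎
    where
    open ≡-Reasoning
    σ = insert i j τ

  permMonomial-remove : ∀ {s} (a b : Fin (suc s) → Fin n) i (σ : Permutation′ (suc s)) →
    permMonomial a b σ ≈ₘ
    (permMonomial (a ∘ punchIn i) (b ∘ punchIn (σ ⟨$⟩ʳ i)) (remove i σ) ·ₘ var (a i) (b (σ ⟨$⟩ʳ i)))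
  permMonomial-remove a b i σ =
    ≈ₘ-trans (permMonomial-cong a b {σ} {insert i σi (remove i σ)} (sym ∘ insert-remove i σ))
             (permMonomial-insert a b i σi (remove i σ))
    where σi = σ ⟨$⟩ʳ i

  module _ {s} (a b : Fin s → Fin n) (a-inj : Injective _≡_ _≡_ a) (b-inj : Injective _≡_ _≡_ b)
    where

    permMonomial-divisible⇒ : ∀ σ {i j} → 1 ≤ permMonomial a b σ (a i) (b j) → σ ⟨$⟩ʳ i ≡ j
    permMonomial-divisible⇒ σ {i} {j} 1≤σij with σ ⟨$⟩ʳ i ≟ j
    ... | yes σi≡j = σi≡j
    ... | no σi≢j  = contradiction (subst (1 ≤_) (sumFin-zero term≡0) 1≤σij) λ ()
      where
      term≡0 : ∀ r → var (a r) (b (σ ⟨$⟩ʳ r)) (a i) (b j) ≡ 0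
      term≡0 r with r ≟ i
      ... | yes refl = var-offCol (σi≢j ∘ sym ∘ b-inj)
      ... | no r≢i   = var-offRow (r≢i ∘ sym ∘ a-inj)

  module _ {s} (a b : Fin (suc s) → Fin n) where

    IsPermMonomial-expand : ∀ i → IsPermMonomial a b ≐ ⋃ (Fin (suc s)) (IsPermMonomialAt a b i)
    IsPermMonomial-expand i = expand , collapse
      where
      expand : ∀ {m} → IsPermMonomial a b m → Σ (Fin (suc s)) λ j → IsPermMonomialAt a b i j m
      expand (σ , m≈σ) =
        σ ⟨$⟩ʳ i , _ , (remove i σ , ≈ₘ-refl) , ≈ₘ-trans m≈σ (permMonomial-remove a b i σ)
      collapse : ∀ {m} → (Σ (Fin (suc s)) λ j → IsPermMonomialAt a b i j m) → IsPermMonomial a b m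
      collapse (j , m′ , (τ , m′≈τ) , m≈m′x) =
        insert i j τ ,
        ≈ₘ-trans m≈m′x (≈ₘ-trans (·ₘ-congʳ _ m′≈τ) (≈ₘ-sym (permMonomial-insert a b i j τ)))

    IsPermMonomialAt-divisible : ∀ {i j m} → IsPermMonomialAt a b i j m → 1 ≤ m (a i) (b j)
    IsPermMonomialAt-divisible {i} {j} (m′ , _ , m≈m′x) =
      subst (1 ≤_) (sym (m≈m′x (a i) (b j))) (·var-divisible m′ (a i) (b j))

    IsPermMonomialAt-unique : Injective _≡_ _≡_ a → Injective _≡_ _≡_ b →
      ∀ {i j j′ m} → IsPermMonomialAt a b i j m → 1 ≤ m (a i) (b j′) → j ≡ j′
    IsPermMonomialAt-unique a-inj b-inj {i} {j} {j′} {m} at@(_ , (τ , _) , _) 1≤mij′ =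
      trans (sym (insert-diag i j τ)) (permMonomial-divisible⇒ a b a-inj b-inj (insert i j τ) 1≤σij′)
      where
      m≈σ : m ≈ₘ permMonomial a b (insert i j τ)
      m≈σ = proj₂ (proj₂ (IsPermMonomial-expand i) (j , at))
      1≤σij′ = subst (1 ≤_) (m≈σ (a i) (b j′)) 1≤mij′

    IsPermMonomialAt-column : Injective _≡_ _≡_ a → Injective _≡_ _≡_ b →
      ∀ {i j m} → (Σ (Fin (suc s)) λ j′ → IsPermMonomialAt a b i j′ m) → 1 ≤ m (a i) (b j) →
      IsPermMonomialAt a b i j m
    IsPermMonomialAt-column a-inj b-inj {i} {m = m} (j′ , at) 1≤mij =
      subst (λ j → IsPermMonomialAt a b i j m) (IsPermMonomialAt-unique a-inj b-inj at 1≤mij) at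

module _ {c ℓ} (K : Field c ℓ) (n : ℕ) where
  open Field K
    using (Carrier; _≈_; _≉_; _+_; _*_; -_; 0#; 1#; 1≉0; ring
          ; +-cong; +-identityˡ; +-identityʳ; *-identityˡ; -‿cong)
    renaming (refl to ≈-refl; sym to ≈-sym; trans to ≈-trans; reflexive to ≈-reflexive)
  open RingProperties ring using (-0#≈0#; -‿+-comm; -‿injective)
  open Poly K n

  coeff-cong : ∀ p {m m′} → m ≈ₘ m′ → coeff p m ≈ coeff p m′
  coeff-cong [] m≈m′ = ≈-refl
  coeff-cong ((_ , u) ∷ p) {m} {m′} m≈m′ with u ≈ₘ? m | u ≈ₘ? m′
  ... | yes _   | yes _    = +-cong ≈-refl (coeff-cong p m≈m′)
  ... | no _    | no _     = coeff-cong p m≈m′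
  ... | yes u≈m | no u≉m′  = contradiction (≈ₘ-trans u≈m m≈m′) u≉m′
  ... | no u≉m  | yes u≈m′ = contradiction (≈ₘ-trans u≈m′ (≈ₘ-sym m≈m′)) u≉m

  coeff-+ₚ : ∀ p q m → coeff (p +ₚ q) m ≈ coeff p m + coeff q m
  coeff-+ₚ [] q m = ≈-sym (+-identityˡ _)
  coeff-+ₚ ((a , u) ∷ p) q m with u ≈ₘ? m
  ... | yes _ = ≈-trans (+-cong ≈-refl (coeff-+ₚ p q m)) (≈-sym (Field.+-assoc K _ _ _))
  ... | no _  = coeff-+ₚ p q m

  coeff-neg : ∀ p m → coeff (-ₚ p) m ≈ - coeff p m
  coeff-neg [] m = ≈-sym -0#≈0#
  coeff-neg ((a , u) ∷ p) m with u ≈ₘ? m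
  ... | yes _ = ≈-trans (+-cong ≈-refl (coeff-neg p m)) (-‿+-comm a (coeff p m))
  ... | no _  = coeff-neg p m

  private
    times-var : Fin n → Fin n → Carrier × Monomial n → Carrier × Monomial n
    times-var k l t = 1# * proj₁ t , var k l ·ₘ proj₂ t

    coeff-X*ₚ : ∀ k l q m → coeff (X k l *ₚ q) m ≡ coeff (map (times-var k l) q) m
    coeff-X*ₚ k l q m = cong (λ p → coeff p m) (++-identityʳ (map (times-var k l) q))

  coeff-X*ₚ-·var : ∀ k l q m → coeff (X k l *ₚ q) (m ·ₘ var k l) ≈ coeff q m
  coeff-X*ₚ-·var k l q m = ≈-trans (≈-reflexive (coeff-X*ₚ k l q (m ·ₘ var k l))) (shifted q)
    where
    shifted : ∀ q → coeff (map (times-var k l) q) (m ·ₘ var k l) ≈ coeff q m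
    shifted [] = ≈-refl
    shifted ((a , u) ∷ q) with (var k l ·ₘ u) ≈ₘ? (m ·ₘ var k l) | u ≈ₘ? m
    ... | yes _    | yes _   = +-cong (*-identityˡ a) (shifted q)
    ... | no _     | no _    = shifted q
    ... | yes xu≈mx | no u≉m =
      contradiction (·ₘ-cancelʳ (var k l) (≈ₘ-trans (·ₘ-comm u (var k l)) xu≈mx)) u≉m
    ... | no xu≉mx  | yes u≈m =
      contradiction (≈ₘ-trans (·ₘ-comm (var k l) u) (·ₘ-congʳ (var k l) u≈m)) xu≉mx

  coeff-X*ₚ-indivisible : ∀ k l q {m} → m k l ≡ 0 → coeff (X k l *ₚ q) m ≈ 0#
  coeff-X*ₚ-indivisible k l q {m} mkl≡0 = ≈-trans (≈-reflexive (coeff-X*ₚ k l q m)) (shifted q)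
    where
    shifted : ∀ q → coeff (map (times-var k l) q) m ≈ 0#
    shifted [] = ≈-refl
    shifted ((a , u) ∷ q) with (var k l ·ₘ u) ≈ₘ? m
    ... | no _     = shifted q
    ... | yes xu≈m = contradiction (subst (1 ≤_) xukl≡0 (·var-divisible u k l)) λ ()
      where xukl≡0 = trans (·ₘ-comm u (var k l) k l) (trans (xu≈m k l) mkl≡0)

  -- Both alternatives are kept explicit because equality in K need not be decidable.
  record SupportIs (p : Poly) (P : Pred (Monomial n) 0ℓ) : Set ℓ where
    field classify : ∀ m → (coeff p m ≈ 0# × m ∉ P) ⊎ (coeff p m ≉ 0# × m ∈ P)
  open SupportIs

  module _ {p P} (supp : SupportIs p P) where

    nonzero⇒∈ : ∀ {m} → coeff p m ≉ 0# → m ∈ P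
    nonzero⇒∈ {m} pm≉0 with supp .classify m
    ... | inj₁ (pm≈0 , _) = contradiction pm≈0 pm≉0
    ... | inj₂ (_ , m∈P)  = m∈P

    ∈⇒nonzero : ∀ {m} → m ∈ P → coeff p m ≉ 0#
    ∈⇒nonzero {m} m∈P with supp .classify m
    ... | inj₁ (_ , m∉P)  = contradiction m∈P m∉P
    ... | inj₂ (pm≉0 , _) = pm≉0

    ∈-resp-≈ₘ : ∀ {m m′} → m ≈ₘ m′ → m ∈ P → m′ ∈ P
    ∈-resp-≈ₘ m≈m′ m∈P = nonzero⇒∈ (∈⇒nonzero m∈P ∘ ≈-trans (coeff-cong p m≈m′))

  SupportIs-≐ : ∀ {p P Q} → P ≐ Q → SupportIs p P → SupportIs p Q
  SupportIs-≐ (P⊆Q , Q⊆P) supp .classify m with supp .classify m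
  ... | inj₁ (pm≈0 , m∉P) = inj₁ (pm≈0 , m∉P ∘ Q⊆P)
  ... | inj₂ (pm≉0 , m∈P) = inj₂ (pm≉0 , P⊆Q m∈P)

  SupportIs-neg : ∀ {p P} → SupportIs p P → SupportIs (-ₚ p) P
  SupportIs-neg {p} supp .classify m with supp .classify m
  ... | inj₁ (pm≈0 , m∉P) = inj₁ (≈-trans (coeff-neg p m) (≈-trans (-‿cong pm≈0) -0#≈0#) , m∉P)
  ... | inj₂ (pm≉0 , m∈P) = inj₂ (pm≉0 ∘ -‿injective ∘ neg≈-0 , m∈P)
    where
    neg≈-0 : coeff (-ₚ p) m ≈ 0# → - coeff p m ≈ - 0#
    neg≈-0 -pm≈0 = ≈-trans (≈-sym (coeff-neg p m)) (≈-trans -pm≈0 (≈-sym -0#≈0#))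

  SupportIs-+ₚ : ∀ {p q P Q} → SupportIs p P → SupportIs q Q → P ⊥ Q → SupportIs (p +ₚ q) (P ∪ Q)
  SupportIs-+ₚ {p} {q} suppP suppQ P⊥Q .classify m with suppP .classify m | suppQ .classify m
  ... | inj₁ (pm≈0 , m∉P) | inj₁ (qm≈0 , m∉Q) =
    inj₁ (≈-trans (coeff-+ₚ p q m) (≈-trans (+-cong pm≈0 qm≈0) (+-identityʳ 0#)) , [ m∉P , m∉Q ])
  ... | inj₁ (pm≈0 , _) | inj₂ (qm≉0 , m∈Q) = inj₂ (qm≉0 ∘ ≈-trans (≈-sym p+q≈q) , inj₂ m∈Q)
    where p+q≈q = ≈-trans (coeff-+ₚ p q m) (≈-trans (+-cong pm≈0 ≈-refl) (+-identityˡ _))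
  ... | inj₂ (pm≉0 , m∈P) | inj₁ (qm≈0 , _) = inj₂ (pm≉0 ∘ ≈-trans (≈-sym p+q≈p) , inj₁ m∈P)
    where p+q≈p = ≈-trans (coeff-+ₚ p q m) (≈-trans (+-cong ≈-refl qm≈0) (+-identityʳ _))
  ... | inj₂ (_ , m∈P) | inj₂ (_ , m∈Q) = ⊥-elim (P⊥Q (m∈P , m∈Q))

  ∑ₚ : ∀ {k} → (Fin k → Poly) → Poly
  ∑ₚ H = foldr _+ₚ_ 0ₚ (tabulate H)

  SupportIs-∑ₚ : ∀ {k} {H : Fin k → Poly} {P : Fin k → Pred (Monomial n) 0ℓ} →
                 (∀ j → SupportIs (H j) (P j)) → (∀ {j j′ m} → m ∈ P j → m ∈ P j′ → j ≡ j′) →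
                 SupportIs (∑ₚ H) (⋃ (Fin k) P)
  SupportIs-∑ₚ {zero} _ _ .classify m = inj₁ (≈-refl , λ ())
  SupportIs-∑ₚ {suc k} {H} {P} supp unique =
    SupportIs-≐ (join , split)
      (SupportIs-+ₚ (supp Fin.zero)
        (SupportIs-∑ₚ (supp ∘ Fin.suc) λ m∈Pᵢ m∈Pⱼ → suc-injective (unique m∈Pᵢ m∈Pⱼ))
        λ (m∈P₀ , (_ , m∈Pⱼ)) → 0≢1+n (unique m∈P₀ m∈Pⱼ))
    where
    join : P Fin.zero ∪ ⋃ (Fin k) (P ∘ Fin.suc) ⊆ ⋃ (Fin (suc k)) P
    join (inj₁ m∈P₀)       = Fin.zero , m∈P₀
    join (inj₂ (j , m∈Pⱼ)) = Fin.suc j , m∈Pⱼ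
    split : ⋃ (Fin (suc k)) P ⊆ P Fin.zero ∪ ⋃ (Fin k) (P ∘ Fin.suc)
    split (Fin.zero , m∈P₀)  = inj₁ m∈P₀
    split (Fin.suc j , m∈Pⱼ) = inj₂ (j , m∈Pⱼ)

  SupportIs-X*ₚ : ∀ k l {q Q} → SupportIs q Q →
                  SupportIs (X k l *ₚ q) (λ m → ∃ λ m′ → m′ ∈ Q × m ≈ₘ (m′ ·ₘ var k l))
  SupportIs-X*ₚ k l {q} supp .classify m with 1 ℕ.≤? m k l
  ... | no 1≰mkl =
    inj₁ ( coeff-X*ₚ-indivisible k l q (ℕ.n<1⇒n≡0 (ℕ.≰⇒> 1≰mkl))
         , λ (m′ , _ , m≈m′x) → 1≰mkl (subst (1 ≤_) (sym (m≈m′x k l)) (·var-divisible m′ k l)))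
  ... | yes 1≤mkl = quotient (divisible⇒·var m 1≤mkl)
    where
    quotient : ∃ (λ m′ → m ≈ₘ (m′ ·ₘ var k l)) → _
    quotient (m′ , m≈m′x) with supp .classify m′
    ... | inj₁ (qm′≈0 , m′∉Q) =
      inj₁ ( ≈-trans coeff≈ qm′≈0
           , λ (m″ , m″∈Q , m≈m″x) →
               m′∉Q (∈-resp-≈ₘ supp (·ₘ-cancelʳ (var k l) (≈ₘ-trans (≈ₘ-sym m≈m″x) m≈m′x)) m″∈Q))
      where coeff≈ = ≈-trans (coeff-cong (X k l *ₚ q) m≈m′x) (coeff-X*ₚ-·var k l q m′)
    ... | inj₂ (qm′≉0 , m′∈Q) = inj₂ (qm′≉0 ∘ ≈-trans (≈-sym coeff≈) , m′ , m′∈Q , m≈m′x)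
      where coeff≈ = ≈-trans (coeff-cong (X k l *ₚ q) m≈m′x) (coeff-X*ₚ-·var k l q m′)

  -- The summands of `det` involve a sign function local to its definition; they can only be
  -- named by reading them off the unfolded definition through unification.
  laplaceTermsOf : ∀ {s} {D : Poly} {H : Fin (suc s) → Poly} →
                   D ≡ foldr _+ₚ_ 0ₚ (map H (tabulate id)) → Fin (suc s) → Poly
  laplaceTermsOf {H = H} _ = H

  laplaceTerm : ∀ {s} → (Fin (suc s) → Fin (suc s) → Poly) → Fin (suc s) → Poly
  laplaceTerm M = laplaceTermsOf {D = det M} refl

  det-laplace : ∀ {s} (M : Fin (suc s) → Fin (suc s) → Poly) → det M ≡ ∑ₚ (laplaceTerm M)
  det-laplace M = cong (foldr _+ₚ_ 0ₚ) (map-tabulate id (laplaceTerm M))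

  SupportIs-alternating : (sg : ℕ → Poly → Poly) → (∀ p → sg 0 p ≡ p) → (∀ p → sg 1 p ≡ -ₚ p) →
                          (∀ k p → sg (suc (suc k)) p ≡ sg k p) →
                          ∀ k {p P} → SupportIs p P → SupportIs (sg k p) P
  SupportIs-alternating sg sg0 sg1 sg2 zero {p} supp =
    subst (λ p′ → SupportIs p′ _) (sym (sg0 p)) supp
  SupportIs-alternating sg sg0 sg1 sg2 (suc zero) {p} supp =
    subst (λ p′ → SupportIs p′ _) (sym (sg1 p)) (SupportIs-neg supp)
  SupportIs-alternating sg sg0 sg1 sg2 (suc (suc k)) {p} supp =
    subst (λ p′ → SupportIs p′ _) (sym (sg2 k p)) (SupportIs-alternating sg sg0 sg1 sg2 k supp)

  SupportIs-laplaceTerm : ∀ {s} (M : Fin (suc s) → Fin (suc s) → Poly) j {P} →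
    SupportIs (M Fin.zero j *ₚ det (λ r c → M (Fin.suc r) (punchIn j c))) P →
    SupportIs (laplaceTerm M j) P
  -- The sign function is a metavariable created before `toℕ j` and the cofactor are abstracted,
  -- so unification later matches it against the local sign function applied to variables.
  SupportIs-laplaceTerm M j
    with SupportIs-alternating _ (λ _ → refl) (λ _ → refl) (λ _ _ → refl)
       | Fin.toℕ j | M Fin.zero j *ₚ det (λ r c → M (Fin.suc r) (punchIn j c))
  ... | alternating | k | p = alternating k

  det-support : ∀ {s} (a b : Fin s → Fin n) → Injective _≡_ _≡_ a → Injective _≡_ _≡_ b →
                SupportIs (det (subM a b)) (IsPermMonomial a b)
  det-support {zero} _ _ _ _ .classify m with (λ _ _ → 0) ≈ₘ? m
  ... | yes 1≈m = inj₂ (1≉0 ∘ ≈-trans (≈-sym (+-identityʳ 1#)) , Permutation.id , ≈ₘ-sym 1≈m)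
  ... | no 1≉m  = inj₁ (≈-refl , λ (_ , m≈1) → 1≉m (≈ₘ-sym m≈1))
  det-support {suc s} a b a-inj b-inj =
    subst (λ p → SupportIs p (IsPermMonomial a b)) (sym (det-laplace (subM a b)))
      (SupportIs-≐ (≐-sym (IsPermMonomial-expand a b Fin.zero)) (SupportIs-∑ₚ column disjoint))
    where
    column : ∀ j → SupportIs (laplaceTerm (subM a b) j) (IsPermMonomialAt a b Fin.zero j)
    column j = SupportIs-laplaceTerm (subM a b) j (SupportIs-X*ₚ (a Fin.zero) (b j)
      (det-support _ _ (∘punchIn-injective Fin.zero a-inj) (∘punchIn-injective j b-inj)))
    disjoint : ∀ {j j′ m} → IsPermMonomialAt a b Fin.zero j m → IsPermMonomialAt a b Fin.zero j′ m →
               j ≡ j′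
    disjoint at at′ = IsPermMonomialAt-unique a b a-inj b-inj at (IsPermMonomialAt-divisible a b at′)

  IsLM-minor : ∀ {s} (a b : Fin (suc s) → Fin n) → Injective _≡_ _≡_ a → Injective _≡_ _≡_ b →
    ∀ i j {L} → IsLM (det (subM a b)) L → 1 ≤ L (a i) (b j) →
    Σ (Monomial n) λ L′ →
      IsLM (det (subM (a ∘ punchIn i) (b ∘ punchIn j))) L′ × ((L′ ·ₘ var (a i) (b j)) ≈ₘ L)
  IsLM-minor a b a-inj b-inj i j {L} (L≉0 , L-max) 1≤Lij =
    L′ , (∈⇒nonzero minor-support L′∈ , L′-max) , ≈ₘ-sym L≈L′x
    where
    support = det-support a b a-inj b-inj
    minor-support = det-support _ _ (∘punchIn-injective i a-inj) (∘punchIn-injective j b-inj)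
    at : IsPermMonomialAt a b i j L
    at = IsPermMonomialAt-column a b a-inj b-inj
           (proj₁ (IsPermMonomial-expand a b i) (nonzero⇒∈ support L≉0)) 1≤Lij
    L′ = proj₁ at
    L′∈ = proj₁ (proj₂ at)
    L≈L′x = proj₂ (proj₂ at)
    L′-max : ∀ m → coeff (det (subM (a ∘ punchIn i) (b ∘ punchIn j))) m ≉ 0# → m ⪯ L′
    L′-max m m≉0 = ⪯-cancelʳ-·ₘ (var (a i) (b j)) (⪯-respʳ-≈ₘ (L-max _ mx≉0) L≈L′x)
      where
      mx≉0 = ∈⇒nonzero support
               (proj₂ (IsPermMonomial-expand a b i) (j , m , nonzero⇒∈ minor-support m≉0 , ≈ₘ-refl))

lemma7p3 : ∀ {c ℓ : Level} (K : Field c ℓ) (n t : ℕ) → 1 ≤ t →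
    (a b : Fin (suc t) → Fin n) → StrictlyIncreasing a → StrictlyIncreasing b →
    (i j : Fin (suc t)) (L : Monomial n) →
    Poly.IsLM K n (Poly.det K n (Poly.subM K n a b)) L →
    1 ≤ L (a i) (b j) →
    Σ (Monomial n) λ L′ →
      Poly.IsLM K n (Poly.det K n (Poly.subM K n (a ∘ punchIn i) (b ∘ punchIn j))) L′ ×
      ((L′ ·ₘ var (a i) (b j)) ≈ₘ L)
lemma7p3 K n _ _ a b a↑ b↑ i j L =
  IsLM-minor K n a b (StrictlyIncreasing⇒Injective a↑) (StrictlyIncreasing⇒Injective b↑) i j
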